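{- Let $U,V,W,X,Y$ be variables and $W_1,W_2$ fresh variables (distinct from them). The set of asymmetric equations $\{V\times W =^{\downarrow} U,\ U =^{\downarrow} X+Y\}$ and the set $\{V\times W =^{\downarrow} U,\ X+Y =^{\downarrow} U\}$ each have the same asymmetric $R,\emptyset$-solutions (on the variables $U,V,W,X,Y$) as the set $\{V\times W =^{\downarrow} U,\ W_1+W_2 =^{\downarrow} W,\ V\times W_1 =^{\downarrow} X,\ V\times W_2 =^{\downarrow} Y\}$.
   Context: Signature: binary symbols $+,\times$; terms are built from these and variables. $R=\{X\times(Y+Z)\to X\times Y+X\times Z\}$, $E=\emptyset$, and $\Delta$ is the equational theory generated by $X\times(Y+Z)=X\times Y+X\times Z$. $R$ is confluent and terminating; $t\downarrow$ denotes the $R$-normal form of $t$. A substitution $\delta$ is an asymmetric $R,\emptyset$-unifier (solution) of a set $\{s_1=^{\downarrow}t_1,\dots,s_n=^{\downarrow}t_n\}$ iff for each $i$, $\delta(s_i)=_\Delta\delta(t_i)$ and $(t_i\downarrow)\delta$ is in $R$-normal form. Standing convention: all substitutions are $R$-normalized, i.e., map every variable to an $R$-normal form. -}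

module Defs where

open import Data.Nat using (ℕ)
open import Data.Product using (_×_; _,_; ∃)
open import Data.List using (List; []; _∷_)
open import Data.List.Relation.Unary.All using (All)
open import Relation.Nullary using (¬_)
open import Relation.Binary.PropositionalEquality using (_≡_; _≢_)

Var : Set
Var = ℕ

infixl 6 _⊕_
infixl 7 _⊗_
data Term : Set where
  var : Var → Term
  _⊕_ : Term → Term → Term
  _⊗_ : Term → Term → Term

Subst : Set
Subst = Var → Term

_[_] : Term → Subst → Term
var x [ σ ] = σ x
(s ⊕ t) [ σ ] = (s [ σ ]) ⊕ (t [ σ ])
(s ⊗ t) [ σ ] = (s [ σ ]) ⊗ (t [ σ ])

infix 4 _⟶_
data _⟶_ : Term → Term → Set where
  root : ∀ x y z → x ⊗ (y ⊕ z) ⟶ (x ⊗ y) ⊕ (x ⊗ z)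
  ⊕ˡ   : ∀ {s s'} t → s ⟶ s' → s ⊕ t ⟶ s' ⊕ t
  ⊕ʳ   : ∀ s {t t'} → t ⟶ t' → s ⊕ t ⟶ s ⊕ t'
  ⊗ˡ   : ∀ {s s'} t → s ⟶ s' → s ⊗ t ⟶ s' ⊗ t
  ⊗ʳ   : ∀ s {t t'} → t ⟶ t' → s ⊗ t ⟶ s ⊗ t'

infix 4 _⟶*_
data _⟶*_ : Term → Term → Set where
  ε   : ∀ {t} → t ⟶* t
  _◅_ : ∀ {s t u} → s ⟶ t → t ⟶* u → s ⟶* u

NF : Term → Set
NF t = ∀ t' → ¬ (t ⟶ t')

infix 4 _≈Δ_
data _≈Δ_ : Term → Term → Set where
  ax     : ∀ x y z → x ⊗ (y ⊕ z) ≈Δ (x ⊗ y) ⊕ (x ⊗ z)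
  refl   : ∀ {t} → t ≈Δ t
  sym    : ∀ {s t} → s ≈Δ t → t ≈Δ s
  trans  : ∀ {s t u} → s ≈Δ t → t ≈Δ u → s ≈Δ u
  cong⊕  : ∀ {s s' t t'} → s ≈Δ s' → t ≈Δ t' → s ⊕ t ≈Δ s' ⊕ t'
  cong⊗  : ∀ {s s' t t'} → s ≈Δ s' → t ≈Δ t' → s ⊗ t ≈Δ s' ⊗ t'

Normalized : Subst → Set
Normalized σ = ∀ x → NF (σ x)

AsymEq : Set
AsymEq = Term × Term

-- δ solves s =↓ t: δ(s) =Δ δ(t) and (t↓)δ is R-normal, where t↓ is the
-- (unique, since R is confluent and terminating) normal form of t, i.e.
-- any n with t ⟶* n and NF n.
SolvesEq : Subst → AsymEq → Set
SolvesEq δ (s , t) =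
  (s [ δ ] ≈Δ t [ δ ]) × (∀ n → t ⟶* n → NF n → NF (n [ δ ]))

-- Asymmetric R,∅-unifier of a set of equations (δ R-normalized by convention).
Solution : List AsymEq → Subst → Set
Solution Γ δ = Normalized δ × All (SolvesEq δ) Γ

AgreeOn : List Var → Subst → Subst → Set
AgreeOn xs σ τ = All (λ x → σ x ≡ τ x) xs

SameSolutionsOn : List Var → List AsymEq → List AsymEq → Set
SameSolutionsOn xs Γ Γ' =
  (∀ δ → Solution Γ δ → ∃ λ δ' → Solution Γ' δ' × AgreeOn xs δ δ')
  × (∀ δ' → Solution Γ' δ' → ∃ λ δ → Solution Γ δ × AgreeOn xs δ δ')

FreshFor : Var → List Var → Set
FreshFor w xs = All (λ x → w ≢ x) xs

-- A Δ-class has a unique R-normal form, computed by distributing every × over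
-- the + nodes of its right argument. Since W's value is normal, the normal
-- form of (VW)δ is a sum exactly when Wδ = a + b, and then the two summands
-- are (Vδ × a)↓ and (Vδ × b)↓; so Vδ × Wδ =Δ Xδ + Yδ forces the split
-- W₁ ↦ a, W₂ ↦ b. Conversely, any solution of the four equations satisfies
-- U =Δ V × (W₁ + W₂) =Δ X + Y, and the normality side conditions are
-- automatic because all right-hand sides are sums of variables.
module Submission where

open import Defs
open import Data.Empty using (⊥-elim)
open import Data.List using (List; []; _∷_)
open import Data.List.Relation.Unary.All as All using (All; []; _∷_)
open import Data.Nat using (_≟_)
open import Data.Product using (_×_; _,_; proj₁; proj₂; ∃; ∃₂; uncurry)
open import Function.Bundles using (_⇔_; mk⇔; Equivalence)
open import Relation.Binary.PropositionalEquality as P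
  using (_≡_; _≢_; refl; cong₂; subst₂)
open import Relation.Nullary using (yes; no)

NF-⊕ : ∀ {s t} → NF s → NF t → NF (s ⊕ t)
NF-⊕ ns nt _ (⊕ˡ _ r) = ns _ r
NF-⊕ ns nt _ (⊕ʳ _ r) = nt _ r

NF-⊕⁻ : ∀ {s t} → NF (s ⊕ t) → NF s × NF t
NF-⊕⁻ {s} {t} h = (λ _ r → h _ (⊕ˡ t r)) , (λ _ r → h _ (⊕ʳ s r))

NF-⊗⁻ : ∀ {s t} → NF (s ⊗ t) → NF s × NF t
NF-⊗⁻ {s} {t} h = (λ _ r → h _ (⊗ˡ t r)) , (λ _ r → h _ (⊗ʳ s r))

NF-var : ∀ x → NF (var x)
NF-var x _ ()

NF⇒⟶*-refl : ∀ {t n} → NF t → t ⟶* n → t ≡ n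
NF⇒⟶*-refl nt ε       = refl
NF⇒⟶*-refl nt (r ◅ _) = ⊥-elim (nt _ r)

mul : Term → Term → Term
mul x (y ⊕ z) = mul x y ⊕ mul x z
mul x y       = x ⊗ y

nf : Term → Term
nf (var v) = var v
nf (s ⊕ t) = nf s ⊕ nf t
nf (s ⊗ t) = mul (nf s) (nf t)

mul≈⊗ : ∀ x y → mul x y ≈Δ x ⊗ y
mul≈⊗ x (y ⊕ z) = trans (cong⊕ (mul≈⊗ x y) (mul≈⊗ x z)) (sym (ax x y z))
mul≈⊗ x (var v) = refl
mul≈⊗ x (y ⊗ z) = refl

nf≈ : ∀ t → nf t ≈Δ t
nf≈ (var v) = refl
nf≈ (s ⊕ t) = cong⊕ (nf≈ s) (nf≈ t)
nf≈ (s ⊗ t) = trans (mul≈⊗ (nf s) (nf t)) (cong⊗ (nf≈ s) (nf≈ t))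

nf-cong : ∀ {s t} → s ≈Δ t → nf s ≡ nf t
nf-cong (ax x y z)  = refl
nf-cong refl        = refl
nf-cong (sym p)     = P.sym (nf-cong p)
nf-cong (trans p q) = P.trans (nf-cong p) (nf-cong q)
nf-cong (cong⊕ p q) = cong₂ _⊕_ (nf-cong p) (nf-cong q)
nf-cong (cong⊗ p q) = cong₂ mul (nf-cong p) (nf-cong q)

nf-NF : ∀ t → NF t → nf t ≡ t
nf-NF (var v)       h = refl
nf-NF (s ⊕ t)       h = cong₂ _⊕_ (nf-NF s (proj₁ (NF-⊕⁻ h))) (nf-NF t (proj₂ (NF-⊕⁻ h)))
nf-NF (s ⊗ var v)   h = P.cong (_⊗ var v) (nf-NF s (proj₁ (NF-⊗⁻ h)))
nf-NF (s ⊗ (t ⊗ u)) h = cong₂ mul (nf-NF s (proj₁ (NF-⊗⁻ h))) (nf-NF (t ⊗ u) (proj₂ (NF-⊗⁻ h)))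
nf-NF (s ⊗ (t ⊕ u)) h = ⊥-elim (h _ (root s t u))

mul-⊕⁻ : ∀ x w {p q} → mul x w ≡ p ⊕ q →
  ∃₂ λ a b → w ≡ a ⊕ b × mul x a ≡ p × mul x b ≡ q
mul-⊕⁻ x (a ⊕ b) refl = a , b , refl , refl , refl

⊗≈⊕-split : ∀ v {w} s t → NF w → v ⊗ w ≈Δ s ⊕ t →
  ∃₂ λ a b → w ≡ a ⊕ b × v ⊗ a ≈Δ s × v ⊗ b ≈Δ t
⊗≈⊕-split v {w} s t nw p
  with mul-⊕⁻ (nf v) w (P.subst (λ u → mul (nf v) u ≡ nf s ⊕ nf t) (nf-NF w nw) (nf-cong p))
... | a , b , w≡a⊕b , va≡s , vb≡t = a , b , w≡a⊕b , summand va≡s , summand vb≡t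
  where
  summand : ∀ {c r} → mul (nf v) c ≡ nf r → v ⊗ c ≈Δ r
  summand {c} {r} eq = trans (cong⊗ (sym (nf≈ v)) refl)
    (trans (sym (mul≈⊗ (nf v) c)) (P.subst (_≈Δ r) (P.sym eq) (nf≈ r)))

_[_≔_] : Subst → Var → Term → Subst
(σ [ w ≔ t ]) x with x ≟ w
... | yes _ = t
... | no  _ = σ x

≔-hit : ∀ σ w t → (σ [ w ≔ t ]) w ≡ t
≔-hit σ w t with w ≟ w
... | yes _   = refl
... | no  w≢w = ⊥-elim (w≢w refl)

≔-miss : ∀ σ {w x} t → w ≢ x → (σ [ w ≔ t ]) x ≡ σ x
≔-miss σ {w} {x} t w≢x with x ≟ w
... | yes refl = ⊥-elim (w≢x refl)
... | no  _    = refl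

≔-normalized : ∀ {σ} w {t} → Normalized σ → NF t → Normalized (σ [ w ≔ t ])
≔-normalized w nσ nt x with x ≟ w
... | yes _ = nt
... | no  _ = nσ x

≔-agree : ∀ σ {w xs} t → FreshFor w xs → AgreeOn xs σ (σ [ w ≔ t ])
≔-agree σ t = All.map λ w≢x → P.sym (≔-miss σ t w≢x)

agree-refl : ∀ xs σ → AgreeOn xs σ σ
agree-refl xs σ = All.tabulate λ _ → refl

agree-trans : ∀ {xs σ τ υ} → AgreeOn xs σ τ → AgreeOn xs τ υ → AgreeOn xs σ υ
agree-trans στ τυ = All.zipWith (uncurry P.trans) (στ , τυ)

solves-NF-rhs : ∀ {δ} s {t} → NF t → s [ δ ] ≈Δ t [ δ ] → NF (t [ δ ]) → SolvesEq δ (s , t)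
solves-NF-rhs s nt p ntδ = p , λ n t⟶*n _ → P.subst (λ u → NF (u [ _ ])) (NF⇒⟶*-refl nt t⟶*n) ntδ

solves-var : ∀ {δ} s x → Normalized δ → s [ δ ] ≈Δ δ x → SolvesEq δ (s , var x)
solves-var s x nδ p = solves-NF-rhs s (NF-var x) p (nδ x)

solves-var⊕var : ∀ {δ} s x y → Normalized δ → s [ δ ] ≈Δ δ x ⊕ δ y → SolvesEq δ (s , var x ⊕ var y)
solves-var⊕var s x y nδ p = solves-NF-rhs s (NF-⊕ (NF-var x) (NF-var y)) p (NF-⊕ (nδ x) (nδ y))

module _ (U V W X Y : Var) where

  ProductIsSum : Subst → Set
  ProductIsSum δ = Normalized δ × (δ V ⊗ δ W ≈Δ δ U) × (δ U ≈Δ δ X ⊕ δ Y)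

  U↓X⊕Y : List AsymEq
  U↓X⊕Y = (var V ⊗ var W , var U) ∷ (var U , var X ⊕ var Y) ∷ []

  X⊕Y↓U : List AsymEq
  X⊕Y↓U = (var V ⊗ var W , var U) ∷ (var X ⊕ var Y , var U) ∷ []

  distributed : Var → Var → List AsymEq
  distributed W₁ W₂ =
    (var V ⊗ var W , var U) ∷ (var W₁ ⊕ var W₂ , var W) ∷
    (var V ⊗ var W₁ , var X) ∷ (var V ⊗ var W₂ , var Y) ∷ []

  solution-U↓X⊕Y⇔ : ∀ δ → Solution U↓X⊕Y δ ⇔ ProductIsSum δ
  solution-U↓X⊕Y⇔ δ = mk⇔
    (λ { (nδ , (VW≈U , _) ∷ (U≈X⊕Y , _) ∷ []) → nδ , VW≈U , U≈X⊕Y })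
    (λ { (nδ , VW≈U , U≈X⊕Y) → nδ ,
        solves-var (var V ⊗ var W) U nδ VW≈U ∷ solves-var⊕var (var U) X Y nδ U≈X⊕Y ∷ [] })

  solution-X⊕Y↓U⇔ : ∀ δ → Solution X⊕Y↓U δ ⇔ ProductIsSum δ
  solution-X⊕Y↓U⇔ δ = mk⇔
    (λ { (nδ , (VW≈U , _) ∷ (X⊕Y≈U , _) ∷ []) → nδ , VW≈U , sym X⊕Y≈U })
    (λ { (nδ , VW≈U , U≈X⊕Y) → nδ ,
        solves-var (var V ⊗ var W) U nδ VW≈U ∷ solves-var (var X ⊕ var Y) U nδ (sym U≈X⊕Y) ∷ [] })

  distributed⇒ProductIsSum : ∀ {W₁ W₂} δ → Solution (distributed W₁ W₂) δ → ProductIsSum δ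
  distributed⇒ProductIsSum δ (nδ , (VW≈U , _) ∷ (W₁⊕W₂≈W , _) ∷ (VW₁≈X , _) ∷ (VW₂≈Y , _) ∷ []) =
    nδ , VW≈U ,
    trans (sym VW≈U) (trans (cong⊗ refl (sym W₁⊕W₂≈W)) (trans (ax _ _ _) (cong⊕ VW₁≈X VW₂≈Y)))

  ProductIsSum⇒distributed : ∀ {W₁ W₂} → FreshFor W₁ (U ∷ V ∷ W ∷ X ∷ Y ∷ []) →
    FreshFor W₂ (U ∷ V ∷ W ∷ X ∷ Y ∷ []) → W₁ ≢ W₂ →
    ∀ δ → ProductIsSum δ →
    ∃ λ δ' → Solution (distributed W₁ W₂) δ' × AgreeOn (U ∷ V ∷ W ∷ X ∷ Y ∷ []) δ δ'
  ProductIsSum⇒distributed {W₁} {W₂} fresh₁ fresh₂ W₁≢W₂ δ (nδ , VW≈U , U≈X⊕Y)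
    with ⊗≈⊕-split (δ V) (δ X) (δ Y) (nδ W) (trans VW≈U U≈X⊕Y)
  ... | a , b , W≡a⊕b , Va≈X , Vb≈Y = δ' , (nδ' , solves agree) , agree
    where
    δ' : Subst
    δ' = (δ [ W₂ ≔ b ]) [ W₁ ≔ a ]

    na×nb : NF a × NF b
    na×nb = NF-⊕⁻ (P.subst NF W≡a⊕b (nδ W))

    nδ' : Normalized δ'
    nδ' = ≔-normalized W₁ (≔-normalized W₂ nδ (proj₂ na×nb)) (proj₁ na×nb)

    agree : AgreeOn (U ∷ V ∷ W ∷ X ∷ Y ∷ []) δ δ'
    agree = agree-trans (≔-agree δ b fresh₂) (≔-agree (δ [ W₂ ≔ b ]) a fresh₁)

    δ'W₁ : a ≡ δ' W₁
    δ'W₁ = P.sym (≔-hit _ W₁ a)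

    δ'W₂ : b ≡ δ' W₂
    δ'W₂ = P.sym (P.trans (≔-miss _ a W₁≢W₂) (≔-hit δ W₂ b))

    solves : AgreeOn (U ∷ V ∷ W ∷ X ∷ Y ∷ []) δ δ' → All (SolvesEq δ') (distributed W₁ W₂)
    solves (eU ∷ eV ∷ eW ∷ eX ∷ eY ∷ []) =
      solves-var (var V ⊗ var W) U nδ' (subst₂ _≈Δ_ (cong₂ _⊗_ eV eW) eU VW≈U) ∷
      solves-var (var W₁ ⊕ var W₂) W nδ' (subst₂ _≈Δ_ (cong₂ _⊕_ δ'W₁ δ'W₂) (P.trans (P.sym W≡a⊕b) eW) refl) ∷
      solves-var (var V ⊗ var W₁) X nδ' (subst₂ _≈Δ_ (cong₂ _⊗_ eV δ'W₁) eX Va≈X) ∷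
      solves-var (var V ⊗ var W₂) Y nδ' (subst₂ _≈Δ_ (cong₂ _⊗_ eV δ'W₂) eY Vb≈Y) ∷ []

  sameSolutions-distributed : ∀ {W₁ W₂} Γ → FreshFor W₁ (U ∷ V ∷ W ∷ X ∷ Y ∷ []) →
    FreshFor W₂ (U ∷ V ∷ W ∷ X ∷ Y ∷ []) → W₁ ≢ W₂ →
    (∀ δ → Solution Γ δ ⇔ ProductIsSum δ) →
    SameSolutionsOn (U ∷ V ∷ W ∷ X ∷ Y ∷ []) Γ (distributed W₁ W₂)
  sameSolutions-distributed Γ fresh₁ fresh₂ W₁≢W₂ Γ⇔ =
    (λ δ sol → ProductIsSum⇒distributed fresh₁ fresh₂ W₁≢W₂ δ (Equivalence.to (Γ⇔ δ) sol)) ,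
    (λ δ sol → δ , Equivalence.from (Γ⇔ δ) (distributed⇒ProductIsSum δ sol) , agree-refl _ δ)

lemma7p7 : (U V W X Y W₁ W₂ : Var) →
    FreshFor W₁ (U ∷ V ∷ W ∷ X ∷ Y ∷ []) →
    FreshFor W₂ (U ∷ V ∷ W ∷ X ∷ Y ∷ []) →
    W₁ ≢ W₂ →
    SameSolutionsOn (U ∷ V ∷ W ∷ X ∷ Y ∷ [])
      ((var V ⊗ var W , var U) ∷ (var U , var X ⊕ var Y) ∷ [])
      ((var V ⊗ var W , var U) ∷ (var W₁ ⊕ var W₂ , var W) ∷ (var V ⊗ var W₁ , var X) ∷ (var V ⊗ var W₂ , var Y) ∷ [])
    ×
    SameSolutionsOn (U ∷ V ∷ W ∷ X ∷ Y ∷ [])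
      ((var V ⊗ var W , var U) ∷ (var X ⊕ var Y , var U) ∷ [])
      ((var V ⊗ var W , var U) ∷ (var W₁ ⊕ var W₂ , var W) ∷ (var V ⊗ var W₁ , var X) ∷ (var V ⊗ var W₂ , var Y) ∷ [])
lemma7p7 U V W X Y W₁ W₂ fresh₁ fresh₂ W₁≢W₂ =
  sameSolutions-distributed U V W X Y _ fresh₁ fresh₂ W₁≢W₂ (solution-U↓X⊕Y⇔ U V W X Y) ,
  sameSolutions-distributed U V W X Y _ fresh₁ fresh₂ W₁≢W₂ (solution-X⊕Y↓U⇔ U V W X Y)
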